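{- There is a quiescently stabilizing content-oblivious algorithm of message complexity $n(2\cdot\mathrm{ID}_{\max}+1)$ that elects a leader and orients a non-oriented ring of $n$ nodes with unique IDs, where $\mathrm{ID}_{\max}$ is the largest ID assigned to a node.
   Context: Content-oblivious model: a ring of $n$ nodes, each node having two ports (Port 0 and Port 1), each connected by a bidirectional channel to one of its two neighbours. Messages are content-free pulses. The network is asynchronous: every pulse is delivered after an arbitrary finite delay; pulses are never lost or injected. Nodes are event-driven (act once at the start and then only upon processing a received pulse), and their behaviour depends only on their own ID and the sequence of pulses received so far (with ports). Algorithms are uniform (nodes do not know $n$). Each node $v$ has a unique ID $\mathrm{ID}(v)\in\mathbb{N}$, and $\mathrm{ID}_{\max}=\max_v\mathrm{ID}(v)$. The ring is non-oriented: the assignment of Port 0/Port 1 to the two neighbours of each node is arbitrary, and the algorithm must work for all such assignments. Quiescently stabilizing algorithm: nodes need not terminate; it is required that eventually no pulses are in transit (quiescence), and at that time the internal states are correct (hence never change again). Here correctness means: exactly one node has state Leader and all others Non-Leader, and each node has labelled exactly one of its ports as its clockwise port such that starting at any node and repeatedly moving to the neighbour at the clockwise port passes through all edges of the ring. Message complexity: total number of pulses sent in a worst-case execution until quiescence. -}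

module Defs where

open import Data.Nat using (ℕ; zero; suc; _+_; _*_; _≤_; _⊔_)
open import Data.Bool using (Bool; true; false; if_then_else_)
open import Data.Fin using (Fin; zero; suc; toℕ; _≟_)
open import Data.Nat.DivMod using (_mod_)
open import Data.List using (List; _∷_; [])
open import Data.Product using (Σ; ∃; _×_; _,_; proj₁; proj₂)
open import Relation.Nullary using (yes; no)
open import Relation.Binary.PropositionalEquality using (_≡_)
open import Relation.Binary.Construct.Closure.ReflexiveTransitive using (Star)

data Port : Set where
  p0 p1 : Port

_≟ₚ_ : Port → Port → Bool
p0 ≟ₚ p0 = true
p1 ≟ₚ p1 = true
_  ≟ₚ _  = false

other : Port → Port
other p0 = p1
other p1 = p0

-- The behaviour of a node depends only on its ID and on the sequence of
-- pulses received so far (the list of arrival ports, most recent first).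
-- It does not know n.
record Algorithm : Set where
  field
    initSend : (ident : ℕ) → Port → ℕ
    -- number of pulses sent on each port upon processing a pulse that
    -- arrives on the given port, given the history before that pulse
    react    : (ident : ℕ) → (history : List Port) → (arrival : Port) → Port → ℕ
    isLeader : (ident : ℕ) → (history : List Port) → Bool
    cwPort   : (ident : ℕ) → (history : List Port) → Port

open Algorithm public

-- A ring of N = suc m nodes: node i (i : Fin N) and node
-- nxt i are joined by edge i.  The port assignment is arbitrary and given
-- by flip : Fin N → Bool: node i's port 0 lies on edge i (towards nxt i)
-- iff flip i ≡ false.  Every non-oriented ring is of this form up to
-- renaming of the nodes.

module Ring (m : ℕ) (flip : Fin (suc m) → Bool) where

  N : ℕ
  N = suc m

  nxt : Fin N → Fin N
  nxt i = (suc (toℕ i)) mod N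

  prv : Fin N → Fin N
  prv i = (toℕ i + m) mod N

  fwd : Fin N → Port
  fwd i = if flip i then p1 else p0

  peer : Fin N → Port → Fin N × Port
  peer i p = if p ≟ₚ fwd i then (nxt i , other (fwd (nxt i)))
                           else (prv i , fwd (prv i))

  -- the edge at port p of node i, together with the neighbour reached
  move : Fin N → Port → Fin N × Fin N
  move i p = if p ≟ₚ fwd i then (nxt i , i) else (prv i , prv i)

sumFin : (n : ℕ) → (Fin n → ℕ) → ℕ
sumFin zero    f = 0
sumFin (suc n) f = f zero + sumFin n (λ i → f (suc i))

maxFin : (n : ℕ) → (Fin n → ℕ) → ℕ
maxFin zero    f = 0
maxFin (suc n) f = f zero ⊔ maxFin n (λ i → f (suc i))

module Exec (A : Algorithm) (m : ℕ) (flip : Fin (suc m) → Bool)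
            (ID : Fin (suc m) → ℕ) where

  open Ring m flip public

  record Config : Set where
    constructor config
    field
      hist    : Fin N → List Port        -- pulses received so far (newest first)
      transit : Fin N → Port → ℕ          -- pulses in transit towards (node, arrival port)
      sent    : ℕ

  open Config public

  -- pulses arriving at endpoint (j , q) come from endpoint peer j q
  initial : Config
  initial = config
    (λ _ → [])
    (λ j q → initSend A (ID (proj₁ (peer j q))) (proj₂ (peer j q)))
    (sumFin N (λ i → initSend A (ID i) p0 + initSend A (ID i) p1))

  update : {X : Set} → (Fin N → X) → Fin N → X → Fin N → X
  update f j x k with k ≟ j
  ... | yes _ = x
  ... | no  _ = f k

  dec : ℕ → ℕ
  dec zero    = zero
  dec (suc k) = k

  deliver : Config → Fin N → Port → Config
  deliver c j q = config
    (update (hist c) j (q ∷ hist c j))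
    (λ x r → let t = (if (x ≟' j) ∧' (r ≟ₚ q) then dec (transit c x r) else transit c x r)
             in t + (if proj₁ (peer x r) ≟' j then out (proj₂ (peer x r)) else 0))
    (sent c + out p0 + out p1)
    where
      out : Port → ℕ
      out = react A (ID j) (hist c j) q
      _≟'_ : Fin N → Fin N → Bool
      a ≟' b with a ≟ b
      ... | yes _ = true
      ... | no  _ = false
      _∧'_ : Bool → Bool → Bool
      true  ∧' b = b
      false ∧' _ = false

  data Step : Config → Config → Set where
    step : ∀ c j q k → transit c j q ≡ suc k → Step c (deliver c j q)

  Reachable : Config → Set
  Reachable c = Star Step initial c

  Quiescent : Config → Set
  Quiescent c = ∀ j q → transit c j q ≡ 0

  leaderAt : Config → Fin N → Bool
  leaderAt c i = isLeader A (ID i) (hist c i)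

  position : Config → Fin N → ℕ → Fin N
  position c s zero    = s
  position c s (suc k) = proj₁ (move (position c s k) (cwPort A (ID (position c s k)) (hist c (position c s k))))

  edgeAt : Config → Fin N → ℕ → Fin N
  edgeAt c s k = proj₂ (move (position c s k) (cwPort A (ID (position c s k)) (hist c (position c s k))))

  Correct : Config → Set
  Correct c =
    (Σ (Fin N) λ l → leaderAt c l ≡ true × (∀ j → leaderAt c j ≡ true → j ≡ l))
    × (∀ (s e : Fin N) → ∃ λ k → edgeAt c s k ≡ e)

  pulsesSent : Config → ℕ
  pulsesSent c = sent c

{-# OPTIONS --safe #-}
module Submission where

-- Every node v sends ID(v) + 1 pulses on port 0 and ID(v) pulses on port 1,
-- and relays a pulse arriving on one port to the other port exactly when the
-- number received on the arrival port exceeds what it has sent on the other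
-- one.  Hence a node has always sent, in each direction, the maximum of its
-- own quota and what it received from behind; by induction over the execution
-- no node ever sends more in a direction than the largest quota in that
-- direction.  With unique IDs these two maxima are ID_max and ID_max + 1, so
-- each of the n nodes sends at most 2 ID_max + 1 pulses.  At quiescence
-- every pulse sent has been received, so each node sends forward at least
-- what its predecessor sent forward; around the ring this amount is therefore
-- constant, equal to the forward maximum, and likewise backward.  Thus only
-- the node of maximal ID receives exactly its own ID on port 0, and every
-- node receives ID_max pulses from one direction and ID_max + 1 from the
-- other, which orients the ring consistently.

open import Defs
open import Data.Bool using (Bool; true; false; if_then_else_)
open import Data.Bool.Properties using (T-≡)
open import Data.Fin using (Fin; toℕ) renaming (_≟_ to _≟ᶠ_)
open import Data.Fin.Properties using (toℕ-injective; toℕ<n; toℕ-fromℕ<)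
  renaming (suc-injective to Fin-suc-injective)
open import Data.List using (List; []; _∷_)
open import Data.Nat
open import Data.Nat.DivMod
  using (_%_; _mod_; m%n<n; m%n%n≡m%n; %-distribˡ-+; [m+n]%n≡m%n; m<n⇒m%n≡m)
open import Data.Nat.GeneralisedArithmetic using (fold; fold-+)
open import Data.Nat.Properties
open import Algebra.Properties.CommutativeSemigroup +-commutativeSemigroup
  using (xy∙z≈xz∙y; interchange)
open import Data.Nat.Tactic.RingSolver using (solve-∀)
open import Data.Product using (Σ; ∃; _×_; _,_; proj₁; proj₂; uncurry)
open import Data.Sum using (_⊎_; inj₁; inj₂)
open import Function.Base using (_∘′_) renaming (flip to flip′)
open import Function.Bundles using (Equivalence)
open import Function.Definitions using (Injective)
open import Relation.Binary.Definitions using (Reflexive; Transitive)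
open import Relation.Binary.PropositionalEquality
open import Relation.Binary.Construct.Closure.ReflexiveTransitive using (Star; ε; _◅_)
open import Relation.Nullary using (yes; no; does; contradiction)
open import Relation.Nullary.Decidable using (dec-true; dec-false)

module _ {X : Set} where

  fold-suc : ∀ (x : X) f k → fold x f (suc k) ≡ fold (f x) f k
  fold-suc x f k = trans (cong (fold x f) (+-comm 1 k)) (fold-+ x f k)

  fold-inverseˡ : ∀ {f g : X → X} → (∀ x → g (f x) ≡ x) →
                  ∀ x k → fold (fold x f k) g k ≡ x
  fold-inverseˡ g∘f≗id x zero = refl
  fold-inverseˡ {f} {g} g∘f≗id x (suc k) = begin
    fold (f (fold x f k)) g (suc k)  ≡⟨ fold-suc _ g k ⟩
    fold (g (f (fold x f k))) g k    ≡⟨ cong (λ y → fold y g k) (g∘f≗id _) ⟩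
    fold (fold x f k) g k            ≡⟨ fold-inverseˡ g∘f≗id x k ⟩
    x                                ∎
    where open ≡-Reasoning

  fold-preserves : ∀ {R : X → X → Set} {f : X → X} → Reflexive R → Transitive R →
                   (∀ x → R x (f x)) → ∀ x k → R x (fold x f k)
  fold-preserves refl′ _      _    x zero    = refl′
  fold-preserves refl′ trans′ step x (suc k) =
    trans′ (fold-preserves refl′ trans′ step x k) (step _)

[m%n+o]%n≡[m+o]%n : ∀ m o n .{{_ : NonZero n}} → (m % n + o) % n ≡ (m + o) % n
[m%n+o]%n≡[m+o]%n m o n = begin
  (m % n + o) % n          ≡⟨ %-distribˡ-+ (m % n) o n ⟩
  (m % n % n + o % n) % n  ≡⟨ cong (λ x → (x + o % n) % n) (m%n%n≡m%n m n) ⟩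
  (m % n + o % n) % n      ≡⟨ %-distribˡ-+ m o n ⟨
  (m + o) % n              ∎
  where open ≡-Reasoning

sumFin-cong : ∀ n {f g : Fin n → ℕ} → (∀ i → f i ≡ g i) → sumFin n f ≡ sumFin n g
sumFin-cong zero    f≗g = refl
sumFin-cong (suc n) f≗g = cong₂ _+_ (f≗g Fin.zero) (sumFin-cong n (λ i → f≗g (Fin.suc i)))

sumFin-mono-≤ : ∀ n {f g : Fin n → ℕ} → (∀ i → f i ≤ g i) → sumFin n f ≤ sumFin n g
sumFin-mono-≤ zero    f≤g = z≤n
sumFin-mono-≤ (suc n) f≤g =
  +-mono-≤ (f≤g Fin.zero) (sumFin-mono-≤ n (λ i → f≤g (Fin.suc i)))

sumFin-const : ∀ n a → sumFin n (λ _ → a) ≡ n * a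
sumFin-const zero    a = refl
sumFin-const (suc n) a = cong (a +_) (sumFin-const n a)

sumFin-update : ∀ n {f g : Fin n → ℕ} j d → g j ≡ f j + d →
                (∀ i → i ≢ j → g i ≡ f i) → sumFin n g ≡ sumFin n f + d
sumFin-update (suc n) {f} Fin.zero d gj≡ g≗f =
  trans (cong₂ _+_ gj≡ (sumFin-cong n (λ i → g≗f (Fin.suc i) λ ())))
        (xy∙z≈xz∙y (f Fin.zero) d _)
sumFin-update (suc n) {f} {g} (Fin.suc j) d gj≡ g≗f =
  trans (cong₂ _+_ (g≗f Fin.zero λ ()) (sumFin-update n j d gj≡ g≗f′))
        (sym (+-assoc (f Fin.zero) _ d))
  where
    g≗f′ : ∀ i → i ≢ j → g (Fin.suc i) ≡ f (Fin.suc i)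
    g≗f′ i i≢j = g≗f (Fin.suc i) (i≢j ∘′ Fin-suc-injective)

maxFin-upper : ∀ n (f : Fin n → ℕ) i → f i ≤ maxFin n f
maxFin-upper (suc n) f Fin.zero    = m≤m⊔n _ _
maxFin-upper (suc n) f (Fin.suc i) =
  ≤-trans (maxFin-upper n (f ∘′ Fin.suc) i) (m≤n⊔m (f Fin.zero) _)

maxFin-least : ∀ n {f : Fin n → ℕ} {b} → (∀ i → f i ≤ b) → maxFin n f ≤ b
maxFin-least zero    f≤b = z≤n
maxFin-least (suc n) f≤b = ⊔-lub (f≤b Fin.zero) (maxFin-least n (λ i → f≤b (Fin.suc i)))

maxFin-attained : ∀ n (f : Fin (suc n) → ℕ) → ∃ λ i → maxFin (suc n) f ≡ f i
maxFin-attained zero    f = Fin.zero , ⊔-identityʳ (f Fin.zero)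
maxFin-attained (suc n) f with ⊔-sel (f Fin.zero) (maxFin (suc n) (f ∘′ Fin.suc))
... | inj₁ max≡f0 = Fin.zero , max≡f0
... | inj₂ max≡rest with maxFin-attained n (f ∘′ Fin.suc)
...   | i , rest≡fi = Fin.suc i , trans max≡rest rest≡fi

maxFin-at-argmax : ∀ n {f g : Fin n → ℕ} {M} → Injective _≡_ _≡_ f →
                   (∀ i → f i ≤ f M) → (∀ i → f i ≤ g i) → (∀ i → g i ≤ suc (f i)) →
                   maxFin n g ≡ g M
maxFin-at-argmax n {f} {g} {M} f-inj f≤fM f≤g g≤1+f =
  ≤-antisym (maxFin-least n g≤gM) (maxFin-upper n g M)
  where
    g≤gM : ∀ i → g i ≤ g M
    g≤gM i with i ≟ᶠ M
    ... | yes refl = ≤-refl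
    ... | no  i≢M  = begin
      g i        ≤⟨ g≤1+f i ⟩
      suc (f i)  ≤⟨ ≤∧≢⇒< (f≤fM i) (i≢M ∘′ f-inj) ⟩
      f M        ≤⟨ f≤g M ⟩
      g M        ∎
      where open ≤-Reasoning

module RingProperties (m : ℕ) (flip : Fin (suc m) → Bool) where
  open Ring m flip

  private
    toℕ-mod : ∀ a → toℕ (a mod N) ≡ a % N
    toℕ-mod a = toℕ-fromℕ< (m%n<n a N)

    toℕ%N : ∀ (i : Fin N) → toℕ i % N ≡ toℕ i
    toℕ%N i = m<n⇒m%n≡m (toℕ<n i)

  prv-nxt : ∀ i → prv (nxt i) ≡ i
  prv-nxt i = toℕ-injective (begin
    toℕ (prv (nxt i))             ≡⟨ toℕ-mod (toℕ (nxt i) + m) ⟩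
    (toℕ (nxt i) + m) % N         ≡⟨ cong (λ x → (x + m) % N) (toℕ-mod (suc (toℕ i))) ⟩
    (suc (toℕ i) % N + m) % N     ≡⟨ [m%n+o]%n≡[m+o]%n (suc (toℕ i)) m N ⟩
    (suc (toℕ i) + m) % N         ≡⟨ cong (_% N) (+-suc (toℕ i) m) ⟨
    (toℕ i + N) % N               ≡⟨ [m+n]%n≡m%n (toℕ i) N ⟩
    toℕ i % N                     ≡⟨ toℕ%N i ⟩
    toℕ i                         ∎)
    where open ≡-Reasoning

  toℕ-fold-nxt : ∀ s k → toℕ (fold s nxt k) ≡ (toℕ s + k) % N
  toℕ-fold-nxt s zero    = trans (sym (toℕ%N s)) (cong (_% N) (sym (+-identityʳ (toℕ s))))
  toℕ-fold-nxt s (suc k) = begin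
    toℕ (nxt (fold s nxt k))        ≡⟨ toℕ-mod (suc (toℕ (fold s nxt k))) ⟩
    suc (toℕ (fold s nxt k)) % N    ≡⟨ cong (λ x → suc x % N) (toℕ-fold-nxt s k) ⟩
    suc ((toℕ s + k) % N) % N       ≡⟨ cong (_% N) (+-comm 1 _) ⟩
    ((toℕ s + k) % N + 1) % N       ≡⟨ [m%n+o]%n≡[m+o]%n (toℕ s + k) 1 N ⟩
    (toℕ s + k + 1) % N             ≡⟨ cong (_% N) (+-assoc (toℕ s) k 1) ⟩
    (toℕ s + (k + 1)) % N           ≡⟨ cong (λ x → (toℕ s + x) % N) (+-comm k 1) ⟩
    (toℕ s + suc k) % N             ∎
    where open ≡-Reasoning

  nxt-reaches : ∀ s e → ∃ λ k → fold s nxt k ≡ e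
  nxt-reaches s e = (N ∸ toℕ s) + toℕ e , toℕ-injective (begin
    toℕ (fold s nxt (N ∸ toℕ s + toℕ e))  ≡⟨ toℕ-fold-nxt s _ ⟩
    (toℕ s + (N ∸ toℕ s + toℕ e)) % N     ≡⟨ cong (_% N) (+-assoc (toℕ s) _ _) ⟨
    (toℕ s + (N ∸ toℕ s) + toℕ e) % N     ≡⟨ cong (λ x → (x + toℕ e) % N)
                                                   (m+[n∸m]≡n (<⇒≤ (toℕ<n s))) ⟩
    (N + toℕ e) % N                       ≡⟨ cong (_% N) (+-comm N (toℕ e)) ⟩
    (toℕ e + N) % N                       ≡⟨ [m+n]%n≡m%n (toℕ e) N ⟩
    toℕ e % N                             ≡⟨ toℕ%N e ⟩
    toℕ e                                 ∎)
    where open ≡-Reasoning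

  -- Edge i joins i and nxt i, so a backward step from x crosses edge prv x.
  prv-reaches : ∀ s e → ∃ λ k → prv (fold s prv k) ≡ e
  prv-reaches s e with nxt-reaches (nxt e) s
  ... | k , reach≡s = k , (begin
    prv (fold s prv k)                     ≡⟨ cong (λ x → prv (fold x prv k)) reach≡s ⟨
    prv (fold (fold (nxt e) nxt k) prv k)  ≡⟨ cong prv (fold-inverseˡ prv-nxt (nxt e) k) ⟩
    prv (nxt e)                            ≡⟨ prv-nxt e ⟩
    e                                      ∎)
    where open ≡-Reasoning

  bwd : Fin N → Port
  bwd i = other (fwd i)

  other-involutive : ∀ p → other (other p) ≡ p
  other-involutive p0 = refl
  other-involutive p1 = refl

  fwd-or-bwd : ∀ i p → p ≡ fwd i ⊎ p ≡ bwd i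
  fwd-or-bwd i p with flip i | p
  ... | true  | p0 = inj₂ refl
  ... | true  | p1 = inj₁ refl
  ... | false | p0 = inj₁ refl
  ... | false | p1 = inj₂ refl

  peer-fwd : ∀ i → peer i (fwd i) ≡ (nxt i , bwd (nxt i))
  peer-fwd i with flip i
  ... | true  = refl
  ... | false = refl

  peer-bwd : ∀ i → peer i (bwd i) ≡ (prv i , fwd (prv i))
  peer-bwd i with flip i
  ... | true  = refl
  ... | false = refl

  move-fwd : ∀ i → move i (fwd i) ≡ (nxt i , i)
  move-fwd i with flip i
  ... | true  = refl
  ... | false = refl

  move-bwd : ∀ i → move i (bwd i) ≡ (prv i , prv i)
  move-bwd i with flip i
  ... | true  = refl
  ... | false = refl

module Walk (A : Algorithm) (m : ℕ) (flip : Fin (suc m) → Bool) (ID : Fin (suc m) → ℕ)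
            (c : Exec.Config A m flip ID) where
  open Exec A m flip ID
  open RingProperties m flip

  cw : Fin N → Port
  cw i = cwPort A (ID i) (hist c i)

  edgeAt-fold : ∀ {next edge : Fin N → Fin N} → (∀ i → move i (cw i) ≡ (next i , edge i)) →
                ∀ s k → edgeAt c s k ≡ edge (fold s next k)
  edgeAt-fold {next} {edge} cw-moves s k =
    trans (cong (λ i → proj₂ (move i (cw i))) (position≡ k)) (cong proj₂ (cw-moves _))
    where
      position≡ : ∀ k → position c s k ≡ fold s next k
      position≡ zero    = refl
      position≡ (suc k) =
        trans (cong (λ i → proj₁ (move i (cw i))) (position≡ k)) (cong proj₁ (cw-moves _))

  all-edges-fwd : (∀ i → cw i ≡ fwd i) → ∀ s e → ∃ λ k → edgeAt c s k ≡ e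
  all-edges-fwd cw≡fwd s e with nxt-reaches s e
  ... | k , reach≡e = k , trans (edgeAt-fold cw-moves s k) reach≡e
    where
      cw-moves : ∀ i → move i (cw i) ≡ (nxt i , i)
      cw-moves i = trans (cong (move i) (cw≡fwd i)) (move-fwd i)

  all-edges-bwd : (∀ i → cw i ≡ bwd i) → ∀ s e → ∃ λ k → edgeAt c s k ≡ e
  all-edges-bwd cw≡bwd s e with prv-reaches s e
  ... | k , reach≡e = k , trans (edgeAt-fold cw-moves s k) reach≡e
    where
      cw-moves : ∀ i → move i (cw i) ≡ (prv i , prv i)
      cw-moves i = trans (cong (move i) (cw≡bwd i)) (move-bwd i)

received : Port → List Port → ℕ
received p []      = 0
received p (q ∷ h) = if p ≟ₚ q then suc (received p h) else received p h

quota : ℕ → Port → ℕ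
quota ident p0 = suc ident
quota ident p1 = ident

-- k counts the earlier pulses on the arrival port, so the pulse being
-- processed is relayed iff k + 1 exceeds the quota c of the other port.
relay : ℕ → ℕ → ℕ
relay c k with c ≤? k
... | yes _ = 1
... | no  _ = 0

respond : ℕ → List Port → Port → Port → ℕ
respond ident h q p = if q ≟ₚ p then 0 else relay (quota ident p) (received q h)

emitted : ℕ → List Port → Port → ℕ
emitted ident h p = quota ident p ⊔ received (other p) h

alg : Algorithm
alg = record
  { initSend = quota
  ; react    = respond
  ; isLeader = λ ident h → does (received p0 h ≟ ident)
  ; cwPort   = λ ident h → if does (received p0 h <? received p1 h) then p0 else p1
  }

⊔-suc-relay : ∀ c k → c ⊔ suc k ≡ c ⊔ k + relay c k
⊔-suc-relay c k with c ≤? k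
... | yes c≤k = begin
  c ⊔ suc k  ≡⟨ m≤n⇒m⊔n≡n (m≤n⇒m≤1+n c≤k) ⟩
  suc k      ≡⟨ +-comm 1 k ⟩
  k + 1      ≡⟨ cong (_+ 1) (m≤n⇒m⊔n≡n c≤k) ⟨
  c ⊔ k + 1  ∎
  where open ≡-Reasoning
... | no c≰k = begin
  c ⊔ suc k  ≡⟨ m≥n⇒m⊔n≡m (≰⇒> c≰k) ⟩
  c          ≡⟨ +-identityʳ c ⟨
  c + 0      ≡⟨ cong (_+ 0) (m≥n⇒m⊔n≡m (<⇒≤ (≰⇒> c≰k))) ⟨
  c ⊔ k + 0  ∎
  where open ≡-Reasoning

emitted-∷ : ∀ ident h q p → emitted ident (q ∷ h) p ≡ emitted ident h p + respond ident h q p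
emitted-∷ ident h p0 p0 = sym (+-identityʳ _)
emitted-∷ ident h p1 p1 = sym (+-identityʳ _)
emitted-∷ ident h p0 p1 = ⊔-suc-relay ident (received p0 h)
emitted-∷ ident h p1 p0 = ⊔-suc-relay (suc ident) (received p1 h)

emitted-∷-bounded : ∀ ident h q (b : Port → ℕ) → (∀ p → emitted ident h p ≤ b p) →
                    suc (received q h) ≤ b (other q) → ∀ p → emitted ident (q ∷ h) p ≤ b p
emitted-∷-bounded ident h p0 b bounded _     p0 = bounded p0
emitted-∷-bounded ident h p1 b bounded _     p1 = bounded p1
emitted-∷-bounded ident h p0 b bounded 1+r≤b p1 =
  ⊔-lub (≤-trans (m≤m⊔n (quota ident p1) (received p0 h)) (bounded p1)) 1+r≤b
emitted-∷-bounded ident h p1 b bounded 1+r≤b p0 =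
  ⊔-lub (≤-trans (m≤m⊔n (quota ident p0) (received p1 h)) (bounded p0)) 1+r≤b

quota-lower : ∀ ident p → ident ≤ quota ident p
quota-lower ident p0 = n≤1+n ident
quota-lower ident p1 = ≤-refl

quota-upper : ∀ ident p → quota ident p ≤ suc ident
quota-upper ident p0 = ≤-refl
quota-upper ident p1 = n≤1+n ident

quota-+-other : ∀ ident p → quota ident p + quota ident (other p) ≡ 2 * ident + 1
quota-+-other ident p0 = trans (+-comm (suc ident) ident) (quota-+-other ident p1)
quota-+-other ident p1 = x+[1+x]≡2x+1 ident
  where
    x+[1+x]≡2x+1 : ∀ x → x + suc x ≡ 2 * x + 1
    x+[1+x]≡2x+1 = solve-∀

quota-<-other : ∀ ident p →
                quota ident p < quota ident (other p) ⊎ quota ident (other p) < quota ident p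
quota-<-other ident p0 = inj₂ (n<1+n ident)
quota-<-other ident p1 = inj₁ (n<1+n ident)

cwPort-fewer : ∀ ident h p → received p h < received (other p) h → cwPort alg ident h ≡ p
cwPort-fewer ident h p0 r0<r1
  rewrite dec-true (received p0 h <? received p1 h) r0<r1 = refl
cwPort-fewer ident h p1 r1<r0
  rewrite dec-false (received p0 h <? received p1 h) (<-asym r1<r0) = refl

module Analysis (m : ℕ) (flip : Fin (suc m) → Bool) (ID : Fin (suc m) → ℕ) where
  open Exec alg m flip ID
  open RingProperties m flip

  emittedAt : Config → Fin N → Port → ℕ
  emittedAt c i = emitted (ID i) (hist c i)

  emittedTotal : Config → Fin N → ℕ
  emittedTotal c i = emittedAt c i p0 + emittedAt c i p1

  maxFwd maxBwd : ℕ
  maxFwd = maxFin N (λ i → quota (ID i) (fwd i))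
  maxBwd = maxFin N (λ i → quota (ID i) (bwd i))

  capacity : Fin N → Port → ℕ
  capacity i p = if p ≟ₚ fwd i then maxFwd else maxBwd

  capacity-fwd : ∀ i → capacity i (fwd i) ≡ maxFwd
  capacity-fwd i with flip i
  ... | true  = refl
  ... | false = refl

  capacity-bwd : ∀ i → capacity i (bwd i) ≡ maxBwd
  capacity-bwd i with flip i
  ... | true  = refl
  ... | false = refl

  capacity-peer : ∀ j q → uncurry capacity (peer j q) ≡ capacity j (other q)
  capacity-peer j q with fwd-or-bwd j q
  ... | inj₁ refl = begin
    uncurry capacity (peer j (fwd j))  ≡⟨ cong (uncurry capacity) (peer-fwd j) ⟩
    capacity (nxt j) (bwd (nxt j))     ≡⟨ capacity-bwd (nxt j) ⟩
    maxBwd                             ≡⟨ capacity-bwd j ⟨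
    capacity j (bwd j)                 ∎
    where open ≡-Reasoning
  ... | inj₂ refl = begin
    uncurry capacity (peer j (bwd j))  ≡⟨ cong (uncurry capacity) (peer-bwd j) ⟩
    capacity (prv j) (fwd (prv j))     ≡⟨ capacity-fwd (prv j) ⟩
    maxFwd                             ≡⟨ capacity-fwd j ⟨
    capacity j (fwd j)                 ≡⟨ cong (capacity j) (other-involutive (fwd j)) ⟨
    capacity j (other (bwd j))         ∎
    where open ≡-Reasoning

  capacity-sum : ∀ i → capacity i p0 + capacity i p1 ≡ maxFwd + maxBwd
  capacity-sum i with flip i
  ... | true  = +-comm maxBwd maxFwd
  ... | false = refl

  quota≤capacity : ∀ i p → quota (ID i) p ≤ capacity i p
  quota≤capacity i p with fwd-or-bwd i p
  ... | inj₁ refl = subst (quota (ID i) (fwd i) ≤_) (sym (capacity-fwd i))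
                      (maxFin-upper N (λ i → quota (ID i) (fwd i)) i)
  ... | inj₂ refl = subst (quota (ID i) (bwd i) ≤_) (sym (capacity-bwd i))
                      (maxFin-upper N (λ i → quota (ID i) (bwd i)) i)

  record Invariant (c : Config) : Set where
    field
      in-transit      : ∀ j q → transit c j q + received q (hist c j)
                                  ≡ uncurry (emittedAt c) (peer j q)
      sent-total      : sent c ≡ sumFin N (emittedTotal c)
      within-capacity : ∀ i p → emittedAt c i p ≤ capacity i p

  open Invariant

  module _ (c : Config) (j : Fin N) (q : Port) where

    hist-deliver-self : hist (deliver c j q) j ≡ q ∷ hist c j
    hist-deliver-self with j ≟ᶠ j
    ... | yes _   = refl
    ... | no  j≢j = contradiction refl j≢j

    hist-deliver-other : ∀ i → i ≢ j → hist (deliver c j q) i ≡ hist c i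
    hist-deliver-other i i≢j with i ≟ᶠ j
    ... | yes i≡j = contradiction i≡j i≢j
    ... | no  _   = refl

    emittedAt-deliver-self : ∀ p → emittedAt (deliver c j q) j p
                                   ≡ emittedAt c j p + respond (ID j) (hist c j) q p
    emittedAt-deliver-self p =
      trans (cong (λ h → emitted (ID j) h p) hist-deliver-self) (emitted-∷ (ID j) (hist c j) q p)

    emittedTotal-deliver-other : ∀ i → i ≢ j →
                                 emittedTotal (deliver c j q) i ≡ emittedTotal c i
    emittedTotal-deliver-other i i≢j =
      cong (λ h → emitted (ID i) h p0 + emitted (ID i) h p1) (hist-deliver-other i i≢j)

  delivery-conserves : ∀ r q h {t k} o → (r ≡ q → t ≡ suc k) →
                       (if r ≟ₚ q then dec t else t) + o + received r (q ∷ h)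
                         ≡ t + received r h + o
  delivery-conserves p0 p0 h {k = k} o pending rewrite pending refl =
    trans (+-suc (k + o) (received p0 h)) (cong suc (xy∙z≈xz∙y k o (received p0 h)))
  delivery-conserves p1 p1 h {k = k} o pending rewrite pending refl =
    trans (+-suc (k + o) (received p1 h)) (cong suc (xy∙z≈xz∙y k o (received p1 h)))
  delivery-conserves p0 p1 h {t} o _ = xy∙z≈xz∙y t o (received p0 h)
  delivery-conserves p1 p0 h {t} o _ = xy∙z≈xz∙y t o (received p1 h)

  -- The peer of (x , r) may be x itself when the ring has a single node.
  in-transit-step : ∀ c j q k → transit c j q ≡ suc k → Invariant c → ∀ x r →
                    transit (deliver c j q) x r + received r (hist (deliver c j q) x)
                      ≡ uncurry (emittedAt (deliver c j q)) (peer x r)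
  in-transit-step c j q k pending inv x r with peer x r | in-transit inv x r
  ... | y , p | conserved with x ≟ᶠ j | y ≟ᶠ j
  ...   | yes refl | yes refl =
    trans (delivery-conserves r q (hist c x) o (λ { refl → pending }))
          (trans (cong (_+ o) conserved) (sym (emitted-∷ (ID x) (hist c x) q p)))
    where o = respond (ID x) (hist c x) q p
  ...   | yes refl | no _ =
    trans (delivery-conserves r q (hist c x) 0 (λ { refl → pending }))
          (trans (+-identityʳ _) conserved)
  ...   | no _ | yes refl =
    trans (xy∙z≈xz∙y (transit c x r) o (received r (hist c x)))
          (trans (cong (_+ o) conserved) (sym (emitted-∷ (ID y) (hist c y) q p)))
    where o = respond (ID y) (hist c y) q p
  ...   | no _ | no _ =
    trans (cong (_+ received r (hist c x)) (+-identityʳ (transit c x r))) conserved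

  sent-total-step : ∀ c j q → Invariant c →
                    sent (deliver c j q) ≡ sumFin N (emittedTotal (deliver c j q))
  sent-total-step c j q inv = begin
    sent c + o p0 + o p1                       ≡⟨ +-assoc (sent c) (o p0) (o p1) ⟩
    sent c + (o p0 + o p1)                     ≡⟨ cong (_+ (o p0 + o p1)) (sent-total inv) ⟩
    sumFin N (emittedTotal c) + (o p0 + o p1)  ≡⟨ sumFin-update N j (o p0 + o p1) deliverer
                                                    (emittedTotal-deliver-other c j q) ⟨
    sumFin N (emittedTotal (deliver c j q))    ∎
    where
      open ≡-Reasoning
      o = respond (ID j) (hist c j) q

      deliverer : emittedTotal (deliver c j q) j ≡ emittedTotal c j + (o p0 + o p1)
      deliverer = trans (cong₂ _+_ (emittedAt-deliver-self c j q p0) (emittedAt-deliver-self c j q p1))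
                        (interchange (emittedAt c j p0) (o p0) (emittedAt c j p1) (o p1))

  pending-below-capacity : ∀ c j q k → transit c j q ≡ suc k → Invariant c →
                           suc (received q (hist c j)) ≤ capacity j (other q)
  pending-below-capacity c j q k pending inv = begin
    suc (received q (hist c j))            ≤⟨ s≤s (m≤n+m _ k) ⟩
    suc k + received q (hist c j)          ≡⟨ cong (_+ received q (hist c j)) pending ⟨
    transit c j q + received q (hist c j)  ≡⟨ in-transit inv j q ⟩
    uncurry (emittedAt c) (peer j q)       ≤⟨ within-capacity inv _ _ ⟩
    uncurry capacity (peer j q)            ≡⟨ capacity-peer j q ⟩
    capacity j (other q)                   ∎
    where open ≤-Reasoning

  within-capacity-step : ∀ c j q k → transit c j q ≡ suc k → Invariant c →
                         ∀ i p → emittedAt (deliver c j q) i p ≤ capacity i p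
  within-capacity-step c j q k pending inv i p with i ≟ᶠ j
  ... | no _     = within-capacity inv i p
  ... | yes refl = emitted-∷-bounded (ID i) (hist c i) q (capacity i) (within-capacity inv i)
                                     (pending-below-capacity c i q k pending inv) p

  invariant-initial : Invariant initial
  invariant-initial = record
    { in-transit      = λ j q → trans (+-identityʳ _) (sym (⊔-identityʳ _))
    ; sent-total      = sumFin-cong N λ i → sym (cong₂ _+_ (⊔-identityʳ (quota (ID i) p0))
                                                           (⊔-identityʳ (quota (ID i) p1)))
    ; within-capacity = λ i p → subst (_≤ capacity i p) (sym (⊔-identityʳ _))
                                      (quota≤capacity i p)
    }

  invariant-step : ∀ {c c′} → Step c c′ → Invariant c → Invariant c′
  invariant-step (step c j q k pending) inv = record
    { in-transit      = in-transit-step c j q k pending inv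
    ; sent-total      = sent-total-step c j q inv
    ; within-capacity = within-capacity-step c j q k pending inv
    }

  invariant-reachable : ∀ {c} → Reachable c → Invariant c
  invariant-reachable = go invariant-initial
    where
      go : ∀ {c c′} → Invariant c → Star Step c c′ → Invariant c′
      go inv ε          = inv
      go inv (s ◅ rest) = go (invariant-step s inv) rest

  module WithUniqueIDs (ID-injective : Injective _≡_ _≡_ ID) where

    M : Fin N
    M = proj₁ (maxFin-attained m ID)

    maxID≡ID-M : maxFin N ID ≡ ID M
    maxID≡ID-M = proj₂ (maxFin-attained m ID)

    ID≤ID-M : ∀ i → ID i ≤ ID M
    ID≤ID-M i = ≤-trans (maxFin-upper N ID i) (≤-reflexive maxID≡ID-M)

    maxFwd≡ : maxFwd ≡ quota (ID M) (fwd M)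
    maxFwd≡ = maxFin-at-argmax N ID-injective ID≤ID-M
                (λ i → quota-lower (ID i) (fwd i)) (λ i → quota-upper (ID i) (fwd i))

    maxBwd≡ : maxBwd ≡ quota (ID M) (bwd M)
    maxBwd≡ = maxFin-at-argmax N ID-injective ID≤ID-M
                (λ i → quota-lower (ID i) (bwd i)) (λ i → quota-upper (ID i) (bwd i))

    maxFwd+maxBwd : maxFwd + maxBwd ≡ 2 * maxFin N ID + 1
    maxFwd+maxBwd = begin
      maxFwd + maxBwd                              ≡⟨ cong₂ _+_ maxFwd≡ maxBwd≡ ⟩
      quota (ID M) (fwd M) + quota (ID M) (bwd M)  ≡⟨ quota-+-other (ID M) (fwd M) ⟩
      2 * ID M + 1                                 ≡⟨ cong (λ x → 2 * x + 1) maxID≡ID-M ⟨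
      2 * maxFin N ID + 1                          ∎
      where open ≡-Reasoning

    sent-bounded : ∀ c → Reachable c → sent c ≤ N * (2 * maxFin N ID + 1)
    sent-bounded c reachable = begin
      sent c                            ≡⟨ sent-total inv ⟩
      sumFin N (emittedTotal c)         ≤⟨ sumFin-mono-≤ N emittedTotal≤ ⟩
      sumFin N (λ _ → maxFwd + maxBwd)  ≡⟨ sumFin-const N (maxFwd + maxBwd) ⟩
      N * (maxFwd + maxBwd)             ≡⟨ cong (N *_) maxFwd+maxBwd ⟩
      N * (2 * maxFin N ID + 1)         ∎
      where
        open ≤-Reasoning
        inv = invariant-reachable reachable

        emittedTotal≤ : ∀ i → emittedTotal c i ≤ maxFwd + maxBwd
        emittedTotal≤ i = ≤-trans (+-mono-≤ (within-capacity inv i p0) (within-capacity inv i p1))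
                                  (≤-reflexive (capacity-sum i))

    module Quiescence (c : Config) (reachable : Reachable c) (quiescent : Quiescent c) where
      open Walk alg m flip ID c using (cw; all-edges-fwd; all-edges-bwd)

      inv : Invariant c
      inv = invariant-reachable reachable

      received≡emitted : ∀ j q → received q (hist c j) ≡ uncurry (emittedAt c) (peer j q)
      received≡emitted j q =
        trans (cong (_+ received q (hist c j)) (sym (quiescent j q))) (in-transit inv j q)

      emittedFwd emittedBwd : Fin N → ℕ
      emittedFwd i = emittedAt c i (fwd i)
      emittedBwd i = emittedAt c i (bwd i)

      received-bwd-from : ∀ i → received (bwd i) (hist c i) ≡ emittedFwd (prv i)
      received-bwd-from i =
        trans (received≡emitted i (bwd i)) (cong (uncurry (emittedAt c)) (peer-bwd i))

      received-fwd-from : ∀ i → received (fwd i) (hist c i) ≡ emittedBwd (nxt i)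
      received-fwd-from i =
        trans (received≡emitted i (fwd i)) (cong (uncurry (emittedAt c)) (peer-fwd i))

      received-other-bwd : ∀ i → received (other (bwd i)) (hist c i) ≡ received (fwd i) (hist c i)
      received-other-bwd i = cong (λ p → received p (hist c i)) (other-involutive (fwd i))

      emittedFwd-grows : ∀ i → emittedFwd i ≤ emittedFwd (nxt i)
      emittedFwd-grows i = begin
        emittedFwd i                             ≡⟨ cong emittedFwd (prv-nxt i) ⟨
        emittedFwd (prv (nxt i))                 ≡⟨ received-bwd-from (nxt i) ⟨
        received (bwd (nxt i)) (hist c (nxt i))  ≤⟨ m≤n⊔m (quota (ID (nxt i)) (fwd (nxt i))) _ ⟩
        emittedFwd (nxt i)                       ∎
        where open ≤-Reasoning

      emittedBwd-shrinks : ∀ i → emittedBwd (nxt i) ≤ emittedBwd i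
      emittedBwd-shrinks i = begin
        emittedBwd (nxt i)                   ≡⟨ received-fwd-from i ⟨
        received (fwd i) (hist c i)          ≡⟨ received-other-bwd i ⟨
        received (other (bwd i)) (hist c i)  ≤⟨ m≤n⊔m (quota (ID i) (bwd i)) _ ⟩
        emittedBwd i                         ∎
        where open ≤-Reasoning

      -- Capacity bounds these from above; from below, M's quota propagates around the ring.
      emittedFwd≡ : ∀ i → emittedFwd i ≡ maxFwd
      emittedFwd≡ i with nxt-reaches M i
      ... | k , reach≡i = ≤-antisym
        (subst (emittedFwd i ≤_) (capacity-fwd i) (within-capacity inv i (fwd i)))
        (begin
          maxFwd                     ≡⟨ maxFwd≡ ⟩
          quota (ID M) (fwd M)       ≤⟨ m≤m⊔n _ _ ⟩
          emittedFwd M               ≤⟨ fold-preserves {R = λ a b → emittedFwd a ≤ emittedFwd b}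
                                          ≤-refl ≤-trans emittedFwd-grows M k ⟩
          emittedFwd (fold M nxt k)  ≡⟨ cong emittedFwd reach≡i ⟩
          emittedFwd i               ∎)
        where open ≤-Reasoning

      emittedBwd≡ : ∀ i → emittedBwd i ≡ maxBwd
      emittedBwd≡ i with nxt-reaches i M
      ... | k , reach≡M = ≤-antisym
        (subst (emittedBwd i ≤_) (capacity-bwd i) (within-capacity inv i (bwd i)))
        (begin
          maxBwd                     ≡⟨ maxBwd≡ ⟩
          quota (ID M) (bwd M)       ≤⟨ m≤m⊔n _ _ ⟩
          emittedBwd M               ≡⟨ cong emittedBwd reach≡M ⟨
          emittedBwd (fold i nxt k)  ≤⟨ fold-preserves {R = λ a b → emittedBwd b ≤ emittedBwd a}
                                          ≤-refl (flip′ ≤-trans) emittedBwd-shrinks i k ⟩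
          emittedBwd i               ∎)
        where open ≤-Reasoning

      received-fwd : ∀ i → received (fwd i) (hist c i) ≡ quota (ID M) (bwd M)
      received-fwd i = trans (received-fwd-from i) (trans (emittedBwd≡ (nxt i)) maxBwd≡)

      received-bwd : ∀ i → received (bwd i) (hist c i) ≡ quota (ID M) (fwd M)
      received-bwd i = trans (received-bwd-from i) (trans (emittedFwd≡ (prv i)) maxFwd≡)

      ID-M≤received : ∀ i p → ID M ≤ received p (hist c i)
      ID-M≤received i p with fwd-or-bwd i p
      ... | inj₁ refl = subst (ID M ≤_) (sym (received-fwd i)) (quota-lower (ID M) (bwd M))
      ... | inj₂ refl = subst (ID M ≤_) (sym (received-bwd i)) (quota-lower (ID M) (fwd M))

      received-at-M : ∀ p → received p (hist c M) ≡ quota (ID M) (other p)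
      received-at-M p with fwd-or-bwd M p
      ... | inj₁ refl = received-fwd M
      ... | inj₂ refl = trans (received-bwd M) (cong (quota (ID M)) (sym (other-involutive (fwd M))))

      M-leader : leaderAt c M ≡ true
      M-leader = dec-true (received p0 (hist c M) ≟ ID M) (received-at-M p0)

      leader-unique : ∀ j → leaderAt c j ≡ true → j ≡ M
      leader-unique j isLeader =
        ID-injective (≤-antisym (ID≤ID-M j) (subst (ID M ≤_) received≡ID (ID-M≤received j p0)))
        where
          received≡ID : received p0 (hist c j) ≡ ID j
          received≡ID = ≡ᵇ⇒≡ _ _ (Equivalence.from T-≡ isLeader)

      cw-fwd : quota (ID M) (bwd M) < quota (ID M) (fwd M) → ∀ i → cw i ≡ fwd i
      cw-fwd bwd<fwd i = cwPort-fewer (ID i) (hist c i) (fwd i)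
        (subst₂ _<_ (sym (received-fwd i)) (sym (received-bwd i)) bwd<fwd)

      cw-bwd : quota (ID M) (fwd M) < quota (ID M) (bwd M) → ∀ i → cw i ≡ bwd i
      cw-bwd fwd<bwd i = cwPort-fewer (ID i) (hist c i) (bwd i)
        (subst₂ _<_ (sym (received-bwd i)) (sym (trans (received-other-bwd i) (received-fwd i)))
                fwd<bwd)

      all-edges : ∀ s e → ∃ λ k → edgeAt c s k ≡ e
      all-edges with quota-<-other (ID M) (fwd M)
      ... | inj₁ fwd<bwd = all-edges-bwd (cw-bwd fwd<bwd)
      ... | inj₂ bwd<fwd = all-edges-fwd (cw-fwd bwd<fwd)

      correct : Correct c
      correct = (M , M-leader , leader-unique) , all-edges

theorem1p2 : Σ Algorithm λ A →
    ∀ (m : ℕ) (flip : Fin (suc m) → Bool) (ID : Fin (suc m) → ℕ) →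
    Injective _≡_ _≡_ ID →
    (∀ c → Exec.Reachable A m flip ID c →
       Exec.pulsesSent A m flip ID c ≤ suc m * (2 * maxFin (suc m) ID + 1))
    × (∀ c → Exec.Reachable A m flip ID c → Exec.Quiescent A m flip ID c →
       Exec.Correct A m flip ID c)
theorem1p2 = alg , λ m flip ID ID-injective →
  let open Analysis.WithUniqueIDs m flip ID ID-injective
  in sent-bounded , λ c reachable quiescent → Quiescence.correct c reachable quiescent
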